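{- Let $n\in\mathbb{N}$ and $\pi\in S_n'$. For all $x\in[n]$: (1) $\operatorname{col}_\pi(x)=\operatorname{col}_{\alpha_\pi}(T_\pi(x))$; (2) $\operatorname{row}_\pi(x)=\operatorname{row}_{\alpha_\pi}(T_\pi(x))$; (3) $\operatorname{colpos}_\pi(x)=\operatorname{colpos}_{\alpha_\pi}(T_\pi(x))$; (4) if $\operatorname{col}_\pi(x)>1$ then $T_\pi(\operatorname{leftof}_\pi(x))=\operatorname{leftof}_{\alpha_\pi}(T_\pi(x))$; (5) if $\operatorname{colpos}_\pi(x)>1$ then $T_\pi(\operatorname{upof}_\pi(x))=\operatorname{upof}_{\alpha_\pi}(T_\pi(x))$.
   Context: A "permutation" may be any finite sequence of distinct integers. West's stack-sorting map $s$: read the input left to right with an initially empty stack; repeatedly, if the input is nonempty and either the stack is empty or the top of the stack is greater than the next input entry, push the next entry; otherwise pop the top of the stack and append it to the output; stop when input and stack are empty. $\operatorname{sc}(\pi)$ is the least $k\ge0$ with $s^k(\pi)$ increasing. $S_n'$ is the set of permutations of $\{0,1,\dots,n\}$ whose last entry is $0$. For $\pi\in S_n'$ and $1\le i\le\operatorname{sc}(\pi)$ let $\sigma=s^{i-1}(\pi)$. Let $c_{\pi,i,1}$ be the maximum of the entries of $\sigma$ strictly left of $0$; for $j\ge2$, as long as some entry of $\sigma$ lies strictly between $c_{\pi,i,j-1}$ and $0$, let $c_{\pi,i,j}$ be the maximum of those entries; otherwise stop. This gives $C_{\pi,i}=(c_{\pi,i,1},\dots,c_{\pi,i,|C_{\pi,i}|})$.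 Blocks: $b_{\pi,i,1}$ is the contiguous subsequence of $\sigma$ strictly before $c_{\pi,i,1}$, and $b_{\pi,i,j}$ ($j\ge2$) the contiguous subsequence strictly between $c_{\pi,i,j-1}$ and $c_{\pi,i,j}$. Every $x\in[n]$ equals $c_{\pi,i,j}$ for a unique pair $(i,j)$; set $\operatorname{col}_\pi(x)=i$, $\operatorname{colpos}_\pi(x)=j$. If $\operatorname{col}_\pi(x)>1$, there is a unique $j$ with $x=\max(b_{\pi,\operatorname{col}_\pi(x)-1,j})$, and $\operatorname{leftof}_\pi(x):=c_{\pi,\operatorname{col}_\pi(x)-1,j}$. Recursively $\operatorname{row}_\pi(x)=\operatorname{colpos}_\pi(x)$ if $\operatorname{col}_\pi(x)=1$, and $\operatorname{row}_\pi(x)=\operatorname{row}_\pi(\operatorname{leftof}_\pi(x))$ otherwise. If $\operatorname{colpos}_\pi(x)>1$, $\operatorname{upof}_\pi(x):=c_{\pi,\operatorname{col}_\pi(x),\operatorname{colpos}_\pi(x)-1}$. The composition $\alpha_\pi=(|\{x\in[n]:\operatorname{row}_\pi(x)=j\}|)_{j=1}^{|C_{\pi,1}|}$. For a composition $\alpha=(\alpha_1,\dots,\alpha_k)$, $D(\alpha)=\{(i,j)\in\mathbb{N}^2: 1\le j\le k,\ i\le\alpha_j\}$. $T_\pi:[n]\to D(\alpha_\pi)$, $T_\pi(x)=(\operatorname{col}_\pi(x),\operatorname{row}_\pi(x))$. For a composition $\alpha$ and $(i,j)\in\mathbb{N}^2$, let $U=\{(i,j')\in D(\alpha): j'<j\}\cup\{(i,0)\}$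 and define $\operatorname{col}_\alpha(i,j)=i$, $\operatorname{row}_\alpha(i,j)=j$, $\operatorname{colpos}_\alpha(i,j)=|U|$, $\operatorname{leftof}_\alpha(i,j)=(i-1,j)$, $\operatorname{upof}_\alpha(i,j)=(i,\max_{(i,j')\in U}j')$. -}

module Defs where

open import Data.Nat using (ℕ; zero; suc; _+_; _∸_; _⊔_; _≡ᵇ_; _<ᵇ_; _≤ᵇ_)
open import Data.Bool using (Bool; true; false; if_then_else_; _∧_)
open import Data.List using (List; []; _∷_; _++_; length; map; filterᵇ; foldr; applyUpTo)
open import Data.Maybe using (Maybe; just; nothing)
open import Data.Product using (_×_; _,_; proj₁; proj₂)

-- West's stack-sorting map, literally as the stack algorithm.
-- stackGo input stack  (stack is a list whose head is the top)

stackGo : List ℕ → List ℕ → List ℕ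
stackGo []       st       = st
stackGo (x ∷ xs) []       = stackGo xs (x ∷ [])
stackGo (x ∷ xs) (t ∷ st) =
  if x <ᵇ t then stackGo xs (x ∷ t ∷ st)
            else t ∷ stackGo (x ∷ xs) st

s : List ℕ → List ℕ
s π = stackGo π []

sIter : ℕ → List ℕ → List ℕ
sIter zero    π = π
sIter (suc k) π = s (sIter k π)

increasingᵇ : List ℕ → Bool
increasingᵇ []           = true
increasingᵇ (x ∷ [])     = true
increasingᵇ (x ∷ y ∷ r)  = (x <ᵇ y) ∧ increasingᵇ (y ∷ r)

firstFrom : (ℕ → Bool) → ℕ → ℕ → ℕ
firstFrom p k zero    = k
firstFrom p k (suc f) = if p k then k else firstFrom p (suc k) f

-- sc(π): least k ≥ 0 with s^k(π) increasing.  The search is bounded by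
-- length π, which suffices since s^(m-1) sorts any list of m distinct entries.
sc : List ℕ → ℕ
sc π = firstFrom (λ k → increasingᵇ (sIter k π)) 0 (length π)

maxL : List ℕ → ℕ
maxL = foldr _⊔_ 0

maxᴹ : List ℕ → Maybe ℕ
maxᴹ []       = nothing
maxᴹ (x ∷ xs) = just (maxL (x ∷ xs))

beforeZero : List ℕ → List ℕ
beforeZero []       = []
beforeZero (x ∷ xs) = if x ≡ᵇ 0 then [] else x ∷ beforeZero xs

splitOn : ℕ → List ℕ → List ℕ × List ℕ
splitOn m []       = [] , []
splitOn m (x ∷ xs) = if x ≡ᵇ m then ([] , xs)
                     else (x ∷ proj₁ (splitOn m xs) , proj₂ (splitOn m xs))

-- Given the segment L strictly between c_{j-1} (or the start) and 0:
-- c_j = max L, b_j = part of L before c_j; continue on the part after c_j.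
-- Produces the list of pairs (b_{π,i,j}, c_{π,i,j}), j = 1,2,...
-- (fuel = length of the segment suffices: each step removes an entry)
chainF : ℕ → List ℕ → List (List ℕ × ℕ)
chainF zero    L        = []
chainF (suc f) []       = []
chainF (suc f) (x ∷ xs) =
  (proj₁ (splitOn (maxL (x ∷ xs)) (x ∷ xs)) , maxL (x ∷ xs))
    ∷ chainF f (proj₂ (splitOn (maxL (x ∷ xs)) (x ∷ xs)))

column : List ℕ → List (List ℕ × ℕ)
column σ = chainF (length σ) (beforeZero σ)

-- colData π i = list of (b_{π,i,j} , c_{π,i,j}) for j = 1..|C_{π,i}|, σ = s^{i-1}(π)
colData : List ℕ → ℕ → List (List ℕ × ℕ)
colData π i = column (sIter (i ∸ 1) π)

-- 1-indexed lookup with default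
nthD : {A : Set} → A → List A → ℕ → A
nthD d []       _             = d
nthD d (x ∷ xs) zero          = d
nthD d (x ∷ xs) (suc zero)    = x
nthD d (x ∷ xs) (suc (suc j)) = nthD d xs (suc j)

findC : ℕ → List (List ℕ × ℕ) → Maybe ℕ
findC x []             = nothing
findC x ((b , c) ∷ cs) = if c ≡ᵇ x then just 1 else mapSuc (findC x cs)
  where
  mapSuc : Maybe ℕ → Maybe ℕ
  mapSuc nothing  = nothing
  mapSuc (just j) = just (suc j)

searchCol : List ℕ → ℕ → ℕ → ℕ → ℕ × ℕ
searchCol π x i zero    = 0 , 0
searchCol π x i (suc f) with findC x (colData π i)
... | just j  = i , j
... | nothing = searchCol π x (suc i) f

colColpos : List ℕ → ℕ → ℕ × ℕ
colColpos π x = searchCol π x 1 (sc π)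

colπ : List ℕ → ℕ → ℕ
colπ π x = proj₁ (colColpos π x)

colposπ : List ℕ → ℕ → ℕ
colposπ π x = proj₂ (colColpos π x)

leftofIn : ℕ → List (List ℕ × ℕ) → ℕ
leftofIn x []             = 0
leftofIn x ((b , c) ∷ cs) with maxᴹ b
... | just m  = if m ≡ᵇ x then c else leftofIn x cs
... | nothing = leftofIn x cs

leftofπ : List ℕ → ℕ → ℕ
leftofπ π x = leftofIn x (colData π (colπ π x ∸ 1))

-- row_π(x) = colpos_π(x) if col_π(x) = 1, else row_π(leftof_π(x));
-- the recursion is run with fuel col_π(x) (col drops by one at each step)
rowF : List ℕ → ℕ → ℕ → ℕ
rowF π zero    x = 0
rowF π (suc f) x = if colπ π x ≡ᵇ 1 then colposπ π x else rowF π f (leftofπ π x)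

rowπ : List ℕ → ℕ → ℕ
rowπ π x = rowF π (colπ π x) x

upofπ : List ℕ → ℕ → ℕ
upofπ π x = proj₂ (nthD ([] , 0) (colData π (colπ π x)) (colposπ π x ∸ 1))

oneTo : ℕ → List ℕ
oneTo m = applyUpTo suc m

alphaπ : ℕ → List ℕ → List ℕ
alphaπ n π =
  map (λ j → length (filterᵇ (λ x → rowπ π x ≡ᵇ j) (oneTo n)))
      (oneTo (length (colData π 1)))

Tπ : List ℕ → ℕ → ℕ × ℕ
Tπ π x = colπ π x , rowπ π x

-- Composition side.  ℕ in ℕ² is {1,2,...}.

inDᵇ : List ℕ → ℕ × ℕ → Bool
inDᵇ α (i , j) = (1 ≤ᵇ j) ∧ (j ≤ᵇ length α) ∧ (1 ≤ᵇ i) ∧ (i ≤ᵇ nthD 0 α j)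

Uset : List ℕ → ℕ × ℕ → List ℕ
Uset α (i , j) = filterᵇ (λ j' → inDᵇ α (i , j')) (oneTo (j ∸ 1))

colα : List ℕ → ℕ × ℕ → ℕ
colα α (i , j) = i

rowα : List ℕ → ℕ × ℕ → ℕ
rowα α (i , j) = j

-- |U| , U = {(i,j') ∈ D(α) : j' < j} ∪ {(i,0)}
colposα : List ℕ → ℕ × ℕ → ℕ
colposα α (i , j) = suc (length (Uset α (i , j)))

leftofα : List ℕ → ℕ × ℕ → ℕ × ℕ
leftofα α (i , j) = (i ∸ 1 , j)

-- (i , max of the second coordinates in U)   (0 from (i,0))
upofα : List ℕ → ℕ × ℕ → ℕ × ℕ
upofα α (i , j) = (i , maxL (0 ∷ Uset α (i , j)))

open import Data.List.Relation.Binary.Permutation.Propositional using (_↭_)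
open import Data.List using (upTo)
open import Data.Product using (∃)
open import Relation.Binary.PropositionalEquality using (_≡_)

S′ : ℕ → List ℕ → Set
S′ n π = (π ↭ upTo (suc n)) × (∃ λ ρ → π ≡ ρ ++ (0 ∷ []))

{-# OPTIONS --safe #-}

-- Write s^k(π) = L_k 0 A_k.  Column k+1 cuts L_k as b₁ c₁ b₂ c₂ … with each c_j larger than everything
-- after it.  Each c_j empties the stack and then stays below everything until 0 has passed, so
-- L_{k+1} = s(b₁) s(b₂) …, and every x ∈ [n] lies in exactly one column.  Since s(b) ends with max b, the
-- entries of column k+2 are maxima of blocks of column k+1, in order, so leftof maps column k+2
-- order-preservingly into column k+1.  Hence the rows met by column k form an increasing subsequence of
-- 1, …, |C_{π,1}| that shrinks as k grows, and row r meets column k exactly when α_r ≥ k.  Reading colpos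
-- and upof off these subsequences gives the formulas on the composition side.

module Submission where

open import Defs
open import Data.Bool using (true; false; if_then_else_; T)
open import Data.Bool.Properties using (if-cong; T-≡; T-∧)
open import Data.List
  using (List; []; _∷_; _++_; [_]; initLast; _∷ʳ′_; length; map; concatMap; filterᵇ; applyUpTo; upTo)
open import Data.List.Properties
  using ( ++-assoc; ++-identityʳ; ∷ʳ-++; ∷-injective; map-++; map-∘; map-cong-local; concatMap-++
        ; length-++; length-++-sucʳ; length-++-≤ˡ; length-map; length-applyUpTo; length-upTo)
open import Data.List.Membership.Propositional using (_∈_; _∉_)
open import Data.List.Membership.Propositional.Properties
  using ( ∈-++⁺ˡ; ∈-++⁺ʳ; ∈-++⁻; ∈-∃++; ∈-map⁺; ∈-map⁻; ∈-filter⁺; ∈-filter⁻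
        ; ∈-applyUpTo⁺; ∈-applyUpTo⁻; ∈-upTo⁺; ∈-upTo⁻)
open import Data.List.Relation.Unary.Any using (here; there)
open import Data.List.Relation.Unary.All as All using (All; []; _∷_)
import Data.List.Relation.Unary.All.Properties as All
open import Data.List.Relation.Unary.AllPairs as AllPairs using (AllPairs; []; _∷_)
import Data.List.Relation.Unary.AllPairs.Properties as AllPairs
open import Data.List.Relation.Unary.Unique.Propositional using (Unique)
open import Data.List.Relation.Unary.Unique.Propositional.Properties as Unique using (Unique[x∷xs]⇒x∉xs; upTo⁺)
open import Data.List.Relation.Binary.Sublist.Heterogeneous using (Sublist; []; _∷_; _∷ʳ_; minimum)
open import Data.List.Relation.Binary.Sublist.Heterogeneous.Properties using (++ˡ)
open import Data.List.Relation.Binary.Sublist.Propositional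
  using (_⊆_; ⊆-reflexive; ⊆-trans) renaming (lookup to ⊆-lookup)
open import Data.List.Relation.Binary.Sublist.Propositional.Properties
  using (All-resp-⊆) renaming (map⁺ to ⊆-map⁺)
open import Data.List.Relation.Binary.Permutation.Propositional
  using (_↭_; ↭-refl; ↭-sym; ↭-trans; ↭-reflexive; ↭-prep; ↭⇒↭ₛ; module PermutationReasoning)
open import Data.List.Relation.Binary.Permutation.Propositional.Properties
  using (shift; ∈-resp-↭; ↭-length; ++⁺ˡ; ++⁺)
import Data.List.Relation.Binary.Permutation.Setoid.Properties as Permutationₛ
open import Data.Maybe using (just; nothing)
open import Data.Maybe.Properties using (just-injective)
open import Data.Nat using (ℕ; zero; suc; _+_; _∸_; _≤_; _<_; _≮_; _≡ᵇ_; _<ᵇ_; _≤ᵇ_; z≤n; s≤s; s≤s⁻¹)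
open import Data.Nat.Properties
open import Data.List.Membership.DecPropositional _≟_ using (_∈?_)
open import Data.Product using (_×_; _,_; proj₁; proj₂; ∃; ∃₂)
open import Data.Sum using (_⊎_; inj₁; inj₂)
open import Function using (_∘_; Equivalence)
open import Relation.Nullary using (yes; no; contradiction)
open import Relation.Nullary.Decidable using (T?)
open import Relation.Nullary.Reflects using (Reflects; ofʸ; ofⁿ; det; fromEquivalence)
open import Relation.Binary.Definitions using (tri<; tri≈; tri>)
open import Relation.Binary.PropositionalEquality hiding ([_])

module _ {m n : ℕ} where

  <ᵇ-true : m < n → (m <ᵇ n) ≡ true
  <ᵇ-true = det (<ᵇ-reflects-< m n) ∘ ofʸ

  <ᵇ-false : m ≮ n → (m <ᵇ n) ≡ false
  <ᵇ-false = det (<ᵇ-reflects-< m n) ∘ ofⁿ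

  ≡ᵇ-reflects-≡ : Reflects (m ≡ n) (m ≡ᵇ n)
  ≡ᵇ-reflects-≡ = fromEquivalence (≡ᵇ⇒≡ m n) (≡⇒≡ᵇ m n)

  ≡ᵇ-true : m ≡ n → (m ≡ᵇ n) ≡ true
  ≡ᵇ-true = det ≡ᵇ-reflects-≡ ∘ ofʸ

  ≡ᵇ-false : m ≢ n → (m ≡ᵇ n) ≡ false
  ≡ᵇ-false = det ≡ᵇ-reflects-≡ ∘ ofⁿ

  ≤ᵇ-true : m ≤ n → (m ≤ᵇ n) ≡ true
  ≤ᵇ-true = det (≤ᵇ-reflects-≤ m n) ∘ ofʸ

if-elim : ∀ {A : Set} (P : A → Set) b {u v : A} → P u → P v → P (if b then u else v)
if-elim P true  Pu _  = Pu
if-elim P false _  Pv = Pv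

if-elim₂ : ∀ {A B : Set} (R : A → B → Set) b {u v : A} {u′ v′ : B} →
  R u u′ → R v v′ → R (if b then u else v) (if b then u′ else v′)
if-elim₂ R true  Ruu′ _    = Ruu′
if-elim₂ R false _    Rvv′ = Rvv′

module _ {A : Set} {R : A → A → Set} where

  AllPairs-++⁻ˡ : ∀ xs {ys} → AllPairs R (xs ++ ys) → AllPairs R xs
  AllPairs-++⁻ˡ []       _          = []
  AllPairs-++⁻ˡ (x ∷ xs) (Rx ∷ Rxs) = All.++⁻ˡ xs Rx ∷ AllPairs-++⁻ˡ xs Rxs

  AllPairs-++⁻ʳ : ∀ xs {ys} → AllPairs R (xs ++ ys) → AllPairs R ys
  AllPairs-++⁻ʳ []       Rys       = Rys
  AllPairs-++⁻ʳ (x ∷ xs) (_ ∷ Rxs) = AllPairs-++⁻ʳ xs Rxs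

  AllPairs-++⁻-across : ∀ xs {ys x y} → AllPairs R (xs ++ ys) → x ∈ xs → y ∈ ys → R x y
  AllPairs-++⁻-across (x ∷ xs) (Rx ∷ _)  (here refl) y∈ = All.lookup (All.++⁻ʳ xs Rx) y∈
  AllPairs-++⁻-across (x ∷ xs) (_ ∷ Rxs) (there x∈)  y∈ = AllPairs-++⁻-across xs Rxs x∈ y∈

  AllPairs-resp-⊆ : ∀ {xs ys} → xs ⊆ ys → AllPairs R ys → AllPairs R xs
  AllPairs-resp-⊆ []             []         = []
  AllPairs-resp-⊆ (y ∷ʳ xs⊆ys)   (_ ∷ Rys)  = AllPairs-resp-⊆ xs⊆ys Rys
  AllPairs-resp-⊆ (refl ∷ xs⊆ys) (Ry ∷ Rys) = All-resp-⊆ xs⊆ys Ry ∷ AllPairs-resp-⊆ xs⊆ys Rys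

module _ {A : Set} where

  Unique-resp-↭ : ∀ {xs ys : List A} → xs ↭ ys → Unique xs → Unique ys
  Unique-resp-↭ xs↭ys = Permutationₛ.Unique-resp-↭ (setoid A) (↭⇒↭ₛ xs↭ys)

  Unique-middle : ∀ xs {v : A} {ys} → Unique (xs ++ v ∷ ys) → v ∉ xs × v ∉ ys
  Unique-middle xs u =
    (λ v∈xs → AllPairs-++⁻-across xs u v∈xs (here refl) refl) ,
    Unique[x∷xs]⇒x∉xs (AllPairs-++⁻ʳ xs u)

  ++-∷-cancelˡ : ∀ {c : A} xs xs′ {ys ys′} → xs ++ c ∷ ys ≡ xs′ ++ c ∷ ys′ → c ∉ xs → c ∉ xs′ → ys ≡ ys′
  ++-∷-cancelˡ []       []        refl _    _     = refl
  ++-∷-cancelˡ []       (_ ∷ _)   refl _    c∉xs′ = contradiction (here refl) c∉xs′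
  ++-∷-cancelˡ (_ ∷ _)  []        refl c∉xs _     = contradiction (here refl) c∉xs
  ++-∷-cancelˡ (_ ∷ xs) (_ ∷ xs′) eq   c∉xs c∉xs′ =
    ++-∷-cancelˡ xs xs′ (proj₂ (∷-injective eq)) (c∉xs ∘ there) (c∉xs′ ∘ there)

  Unique⇒length-≤ : ∀ {xs ys : List A} → Unique xs → (∀ {v} → v ∈ xs → v ∈ ys) → length xs ≤ length ys
  Unique⇒length-≤ {[]}     _          _     = z≤n
  Unique⇒length-≤ {x ∷ xs} (x∉xs ∷ u) xs⊆ys with ∈-∃++ (xs⊆ys (here refl))
  ... | ys₁ , ys₂ , refl = begin
    suc (length xs)           ≤⟨ s≤s (Unique⇒length-≤ u xs⊆ys₁ys₂) ⟩
    suc (length (ys₁ ++ ys₂)) ≡⟨ length-++-sucʳ ys₁ x ys₂ ⟨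
    length (ys₁ ++ x ∷ ys₂)   ∎
    where
    open ≤-Reasoning
    xs⊆ys₁ys₂ : ∀ {v} → v ∈ xs → v ∈ ys₁ ++ ys₂
    xs⊆ys₁ys₂ {v} v∈xs with ∈-++⁻ ys₁ (xs⊆ys (there v∈xs))
    ... | inj₁ v∈ys₁         = ∈-++⁺ˡ v∈ys₁
    ... | inj₂ (here v≡x)    = contradiction (sym v≡x) (All.lookup x∉xs v∈xs)
    ... | inj₂ (there v∈ys₂) = ∈-++⁺ʳ ys₁ v∈ys₂

module _ {A B : Set} where

  concatMap-↭ : ∀ (f g : A → List B) → (∀ x → f x ↭ g x) → ∀ xs → concatMap f xs ↭ concatMap g xs
  concatMap-↭ f g f↭g []       = ↭-refl
  concatMap-↭ f g f↭g (x ∷ xs) = ++⁺ (f↭g x) (concatMap-↭ f g f↭g xs)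

  ∈-concatMap-split : ∀ {y : B} (f : A → List B) xs → y ∈ concatMap f xs →
    ∃₂ λ xs₁ xs₂ → ∃ λ x → xs ≡ xs₁ ++ x ∷ xs₂ × y ∈ f x
  ∈-concatMap-split f (x ∷ xs) y∈ with ∈-++⁻ (f x) y∈
  ... | inj₁ y∈fx = [] , xs , x , refl , y∈fx
  ... | inj₂ y∈fxs with ∈-concatMap-split f xs y∈fxs
  ...   | xs₁ , xs₂ , x′ , refl , y∈fx′ = x ∷ xs₁ , xs₂ , x′ , refl , y∈fx′

  Unique-concatMap-suffix : ∀ (f : A → List B) xs₁ {x xs₂} →
    Unique (concatMap f (xs₁ ++ x ∷ xs₂)) → Unique (f x ++ concatMap f xs₂)
  Unique-concatMap-suffix f xs₁ u = AllPairs-++⁻ʳ (concatMap f xs₁) (subst Unique (concatMap-++ f xs₁ _) u)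

  map-Unique : ∀ (f : A → B) {xs} → Unique xs → (∀ {x y} → x ∈ xs → y ∈ xs → f x ≡ f y → x ≡ y) →
    Unique (map f xs)
  map-Unique f {[]}     _          _   = []
  map-Unique f {x ∷ xs} (x∉xs ∷ u) inj =
    All.map⁺ (All.tabulate λ y∈xs fx≡fy → All.lookup x∉xs y∈xs (inj (here refl) (there y∈xs) fx≡fy))
    ∷ map-Unique f u λ x∈ y∈ → inj (there x∈) (there y∈)

  Unique-map⇒injective : ∀ (f : A → B) {xs x y} → Unique (map f xs) → x ∈ xs → y ∈ xs → f x ≡ f y → x ≡ y
  Unique-map⇒injective f {_ ∷ _} _         (here refl) (here refl) _     = refl
  Unique-map⇒injective f {_ ∷ _} (fx∉ ∷ _) (here refl) (there y∈)  fx≡fy =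
    contradiction fx≡fy (All.lookup fx∉ (∈-map⁺ f y∈))
  Unique-map⇒injective f {_ ∷ _} (fy∉ ∷ _) (there x∈)  (here refl) fx≡fy =
    contradiction (sym fx≡fy) (All.lookup fy∉ (∈-map⁺ f x∈))
  Unique-map⇒injective f {_ ∷ _} (_ ∷ u)   (there x∈)  (there y∈)  fx≡fy =
    Unique-map⇒injective f u x∈ y∈ fx≡fy

increasing⇒Unique : ∀ {xs : List ℕ} → AllPairs _<_ xs → Unique xs
increasing⇒Unique = AllPairs.map <⇒≢

increasing-≡ : ∀ {xs ys : List ℕ} → AllPairs _<_ xs → AllPairs _<_ ys →
  (∀ {v} → v ∈ xs → v ∈ ys) → (∀ {v} → v ∈ ys → v ∈ xs) → xs ≡ ys
increasing-≡ {[]}     {[]}     _ _ _ _ = refl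
increasing-≡ {[]}     {y ∷ _}  _ _ _ ys⊆xs with ys⊆xs (here refl)
... | ()
increasing-≡ {x ∷ _}  {[]}     _ _ xs⊆ys _ with xs⊆ys (here refl)
... | ()
increasing-≡ {x ∷ xs} {y ∷ ys} (x< ∷ <xs) (y< ∷ <ys) xs⊆ys ys⊆xs = cong₂ _∷_ x≡y
  (increasing-≡ <xs <ys
    (λ v∈xs → drop-head (xs⊆ys (there v∈xs)) (subst (_< _) x≡y (All.lookup x< v∈xs)))
    (λ v∈ys → drop-head (ys⊆xs (there v∈ys)) (subst (_< _) (sym x≡y) (All.lookup y< v∈ys))))
  where
  least : ∀ {a b bs} → a ∈ b ∷ bs → All (b <_) bs → b ≤ a
  least (here refl) _  = ≤-refl
  least (there a∈)  b< = <⇒≤ (All.lookup b< a∈)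
  x≡y : x ≡ y
  x≡y = ≤-antisym (least (ys⊆xs (here refl)) x<) (least (xs⊆ys (here refl)) y<)
  drop-head : ∀ {v a as} → v ∈ a ∷ as → a < v → v ∈ as
  drop-head (here refl) a<a = contradiction a<a (<-irrefl refl)
  drop-head (there v∈)  _   = v∈

∈-increasing-prefix : ∀ xs {r ys v} → AllPairs _<_ (xs ++ r ∷ ys) → v ∈ xs ++ r ∷ ys → v < r → v ∈ xs
∈-increasing-prefix xs inc v∈ v<r with ∈-++⁻ xs v∈
... | inj₁ v∈xs         = v∈xs
... | inj₂ (here refl)  = contradiction v<r (<-irrefl refl)
... | inj₂ (there v∈ys) = contradiction v<r (<⇒≯ (All.lookup (AllPairs.head (AllPairs-++⁻ʳ xs inc)) v∈ys))

≤∧∉⇒< : ∀ {m} S → All (_≤ m) S → m ∉ S → All (_< m) S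
≤∧∉⇒< {m} S S≤m m∉S = All.tabulate λ {v} v∈S →
  ≤∧≢⇒< (All.lookup S≤m v∈S) (λ v≡m → m∉S (subst (_∈ S) v≡m v∈S))

<⇒≤∸1 : ∀ {v r} → v < r → v ≤ r ∸ 1
<⇒≤∸1 {r = suc _} (s≤s v≤r) = v≤r

≤∸1⇒< : ∀ {v r} → 1 ≤ r → v ≤ r ∸ 1 → v < r
≤∸1⇒< {r = suc _} _ v≤r = s≤s v≤r

≤-maxL : ∀ {x} L → x ∈ L → x ≤ maxL L
≤-maxL (y ∷ L) (here refl) = m≤m⊔n y (maxL L)
≤-maxL (y ∷ L) (there x∈) = ≤-trans (≤-maxL L x∈) (m≤n⊔m y (maxL L))

maxL-∈ : ∀ x L → maxL (x ∷ L) ∈ x ∷ L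
maxL-∈ x []      = here (⊔-identityʳ x)
maxL-∈ x (y ∷ L) with ⊔-sel x (maxL (y ∷ L))
... | inj₁ x⊔m≡x = here x⊔m≡x
... | inj₂ x⊔m≡m = there (subst (_∈ y ∷ L) (sym x⊔m≡m) (maxL-∈ y L))

maxL-≤ : ∀ {k} L → All (_≤ k) L → maxL L ≤ k
maxL-≤ []      []           = z≤n
maxL-≤ (x ∷ L) (x≤k ∷ L≤k) = ⊔-lub x≤k (maxL-≤ L L≤k)

maxL-increasing : ∀ S {z} → AllPairs _<_ (S ++ [ z ]) → maxL (S ++ [ z ]) ≡ z
maxL-increasing S {z} S<z = ≤-antisym
  (maxL-≤ (S ++ [ z ]) (All.++⁺ (All.tabulate λ v∈S → <⇒≤ (AllPairs-++⁻-across S S<z v∈S (here refl)))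
                                (≤-refl ∷ [])))
  (≤-maxL (S ++ [ z ]) (∈-++⁺ʳ S (here refl)))

maxᴹ-just : ∀ {m} b → maxᴹ b ≡ just m → m ∈ b
maxᴹ-just (x ∷ b) refl = maxL-∈ x b

maxᴹ-of : ∀ {m} b → m ∈ b → All (_≤ m) b → maxᴹ b ≡ just m
maxᴹ-of (x ∷ b) m∈ b≤m = cong just (≤-antisym (maxL-≤ (x ∷ b) b≤m) (≤-maxL (x ∷ b) m∈))

∈-oneTo⁺ : ∀ {y m} → 1 ≤ y → y ≤ m → y ∈ oneTo m
∈-oneTo⁺ {suc _} _ y≤m = ∈-applyUpTo⁺ suc y≤m

∈-oneTo⁻ : ∀ {y m} → y ∈ oneTo m → 1 ≤ y × y ≤ m
∈-oneTo⁻ y∈ with ∈-applyUpTo⁻ suc y∈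
... | _ , i<m , refl = s≤s z≤n , i<m

oneTo-increasing : ∀ m → AllPairs _<_ (oneTo m)
oneTo-increasing m = AllPairs.applyUpTo⁺₁ suc m (λ i<j _ → s≤s i<j)

map≡applyUpTo : ∀ (g f : ℕ → ℕ) K → (∀ pre {x post} → K ≡ pre ++ x ∷ post → g x ≡ f (length pre)) →
  map g K ≡ applyUpTo f (length K)
map≡applyUpTo g f []      _      = refl
map≡applyUpTo g f (k ∷ K) g≡f∘pos =
  cong₂ _∷_ (g≡f∘pos [] refl) (map≡applyUpTo g (f ∘ suc) K λ pre K≡ → g≡f∘pos (k ∷ pre) (cong (k ∷_) K≡))

nthD-map-applyUpTo : ∀ {A : Set} (d : A) (g : ℕ → A) f {m t} → t < m →
  nthD d (map g (applyUpTo f m)) (suc t) ≡ g (f t)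
nthD-map-applyUpTo d g f {suc m} {zero}  _         = refl
nthD-map-applyUpTo d g f {suc m} {suc t} (s≤s t<m) = nthD-map-applyUpTo d g (f ∘ suc) t<m

nthD-position : ∀ {A : Set} (d : A × ℕ) xs pre {y post} → map proj₂ xs ≡ pre ++ y ∷ post →
  proj₂ (nthD d xs (suc (length pre))) ≡ y
nthD-position d (_ ∷ _)  []        xs≡ = proj₁ (∷-injective xs≡)
nthD-position d (_ ∷ xs) (_ ∷ pre) xs≡ = nthD-position d xs pre (proj₂ (∷-injective xs≡))

-- run L st: the output emitted while stackGo reads L starting from stack st, and the stack left at the end.
run : List ℕ → List ℕ → List ℕ × List ℕ
run []       st       = [] , st
run (x ∷ xs) []       = run xs [ x ]
run (x ∷ xs) (t ∷ st) =
  if x <ᵇ t then run xs (x ∷ t ∷ st)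
  else (t ∷ proj₁ (run (x ∷ xs) st) , proj₂ (run (x ∷ xs) st))

stackGo-run : ∀ L st → stackGo L st ≡ proj₁ (run L st) ++ proj₂ (run L st)
stackGo-run []       st       = refl
stackGo-run (x ∷ xs) []       = stackGo-run xs [ x ]
stackGo-run (x ∷ xs) (t ∷ st) =
  if-elim₂ (λ out r → out ≡ proj₁ r ++ proj₂ r) (x <ᵇ t)
    (stackGo-run xs (x ∷ t ∷ st)) (cong (t ∷_) (stackGo-run (x ∷ xs) st))

run-++ : ∀ A B st →
  run (A ++ B) st ≡ (proj₁ (run A st) ++ proj₁ (run B (proj₂ (run A st))) , proj₂ (run B (proj₂ (run A st))))
run-++ []       B st       = refl
run-++ (x ∷ xs) B []       = run-++ xs B [ x ]
run-++ (x ∷ xs) B (t ∷ st) =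
  if-elim₂ (λ r r′ → r ≡ (proj₁ r′ ++ proj₁ (run B (proj₂ r′)) , proj₂ (run B (proj₂ r′)))) (x <ᵇ t)
    (run-++ xs B (x ∷ t ∷ st)) (cong (λ r → t ∷ proj₁ r , proj₂ r) (run-++ (x ∷ xs) B st))

stackGo-++ : ∀ A B st → stackGo (A ++ B) st ≡ proj₁ (run A st) ++ stackGo B (proj₂ (run A st))
stackGo-++ A B st = begin
  stackGo (A ++ B) st                                     ≡⟨ stackGo-run (A ++ B) st ⟩
  proj₁ (run (A ++ B) st) ++ proj₂ (run (A ++ B) st)      ≡⟨ cong (λ r → proj₁ r ++ proj₂ r) (run-++ A B st) ⟩
  (out ++ proj₁ (run B st′)) ++ proj₂ (run B st′)         ≡⟨ ++-assoc out _ _ ⟩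
  out ++ (proj₁ (run B st′) ++ proj₂ (run B st′))         ≡⟨ cong (out ++_) (stackGo-run B st′) ⟨
  out ++ stackGo B st′                                    ∎
  where
  open ≡-Reasoning
  out = proj₁ (run A st)
  st′ = proj₂ (run A st)

stackGo-↭ : ∀ L st → stackGo L st ↭ L ++ st
stackGo-↭ []       st       = ↭-refl
stackGo-↭ (x ∷ xs) []       = ↭-trans (stackGo-↭ xs [ x ]) (shift x xs [])
stackGo-↭ (x ∷ xs) (t ∷ st) =
  if-elim (_↭ x ∷ xs ++ t ∷ st) (x <ᵇ t)
    (↭-trans (stackGo-↭ xs (x ∷ t ∷ st)) (shift x xs (t ∷ st)))
    (↭-trans (↭-prep t (stackGo-↭ (x ∷ xs) st)) (↭-sym (shift t (x ∷ xs) st)))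

s-↭ : ∀ L → s L ↭ L
s-↭ L = ↭-trans (stackGo-↭ L []) (↭-reflexive (++-identityʳ L))

stack-All : ∀ {P : ℕ → Set} L st → All P L → All P st → All P (proj₂ (run L st))
stack-All     []       st       _         Pst        = Pst
stack-All     (x ∷ xs) []       (Px ∷ PL) _          = stack-All xs [ x ] PL (Px ∷ [])
stack-All {P} (x ∷ xs) (t ∷ st) (Px ∷ PL) (Pt ∷ Pst) =
  if-elim (All P ∘ proj₂) (x <ᵇ t)
    (stack-All xs (x ∷ t ∷ st) PL (Px ∷ Pt ∷ Pst)) (stack-All (x ∷ xs) st (Px ∷ PL) Pst)

run-inert-bottom : ∀ M L st → All (_< M) L → All (_< M) st →
  run L (st ++ [ M ]) ≡ (proj₁ (run L st) , proj₂ (run L st) ++ [ M ])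
run-inert-bottom M []       st       _           _            = refl
run-inert-bottom M (x ∷ xs) []       (x<M ∷ L<M) _            =
  trans (if-cong (<ᵇ-true x<M)) (run-inert-bottom M xs [ x ] L<M (x<M ∷ []))
run-inert-bottom M (x ∷ xs) (t ∷ st) (x<M ∷ L<M) (t<M ∷ st<M) =
  if-elim₂ (λ r r′ → r ≡ (proj₁ r′ , proj₂ r′ ++ [ M ])) (x <ᵇ t)
    (run-inert-bottom M xs (x ∷ t ∷ st) L<M (x<M ∷ t<M ∷ st<M))
    (cong (λ r → t ∷ proj₁ r , proj₂ r) (run-inert-bottom M (x ∷ xs) st (x<M ∷ L<M) st<M))

run-pops-all : ∀ c R st → All (_≤ c) st → run (c ∷ R) st ≡ (st ++ proj₁ (run R [ c ]) , proj₂ (run R [ c ]))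
run-pops-all c R []       _            = refl
run-pops-all c R (t ∷ st) (t≤c ∷ st≤c) =
  trans (if-cong (<ᵇ-false (≤⇒≯ t≤c))) (cong (λ r → t ∷ proj₁ r , proj₂ r) (run-pops-all c R st st≤c))

run-split-at-max : ∀ b c r → All (_< c) b → All (_< c) r →
  run (b ++ c ∷ r) [] ≡ (s b ++ proj₁ (run r []) , proj₂ (run r []) ++ [ c ])
run-split-at-max b c r b<c r<c = begin
  run (b ++ c ∷ r) []
    ≡⟨ run-++ b (c ∷ r) [] ⟩
  (out ++ proj₁ (run (c ∷ r) st) , proj₂ (run (c ∷ r) st))
    ≡⟨ cong (λ x → out ++ proj₁ x , proj₂ x) (run-pops-all c r st st≤c) ⟩
  (out ++ (st ++ proj₁ (run r [ c ])) , proj₂ (run r [ c ]))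
    ≡⟨ cong (λ x → out ++ (st ++ proj₁ x) , proj₂ x) (run-inert-bottom c r [] r<c []) ⟩
  (out ++ (st ++ proj₁ (run r [])) , proj₂ (run r []) ++ [ c ])
    ≡⟨ cong (_, _) (++-assoc out st _) ⟨
  ((out ++ st) ++ proj₁ (run r []) , proj₂ (run r []) ++ [ c ])
    ≡⟨ cong (λ x → x ++ proj₁ (run r []) , _) (stackGo-run b []) ⟨
  (s b ++ proj₁ (run r []) , proj₂ (run r []) ++ [ c ])
    ∎
  where
  open ≡-Reasoning
  out = proj₁ (run b [])
  st  = proj₂ (run b [])
  st≤c : All (_≤ c) st
  st≤c = All.map <⇒≤ (stack-All b [] b<c [])

s-split-at-max : ∀ b c r → All (_< c) b → All (_< c) r → s (b ++ c ∷ r) ≡ s b ++ s r ++ [ c ]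
s-split-at-max b c r b<c r<c = begin
  s (b ++ c ∷ r)
    ≡⟨ stackGo-run (b ++ c ∷ r) [] ⟩
  proj₁ (run (b ++ c ∷ r) []) ++ proj₂ (run (b ++ c ∷ r) [])
    ≡⟨ cong (λ x → proj₁ x ++ proj₂ x) (run-split-at-max b c r b<c r<c) ⟩
  (s b ++ out) ++ st ++ [ c ]   ≡⟨ ++-assoc (s b) out _ ⟩
  s b ++ out ++ st ++ [ c ]     ≡⟨ cong (s b ++_) (++-assoc out st _) ⟨
  s b ++ (out ++ st) ++ [ c ]   ≡⟨ cong (λ x → s b ++ x ++ [ c ]) (stackGo-run r []) ⟨
  s b ++ s r ++ [ c ]           ∎
  where
  open ≡-Reasoning
  out = proj₁ (run r [])
  st  = proj₂ (run r [])

s-ends-with-max : ∀ {M} b → Unique b → M ∈ b → All (_≤ M) b → ∃ λ pre → s b ≡ pre ++ [ M ]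
s-ends-with-max b u M∈b b≤M with ∈-∃++ M∈b
... | b₁ , b₂ , refl =
  s b₁ ++ s b₂ , trans (s-split-at-max b₁ _ b₂ b₁<M b₂<M) (sym (++-assoc (s b₁) (s b₂) _))
  where
  b₁<M = ≤∧∉⇒< b₁ (All.++⁻ˡ b₁ b≤M) (proj₁ (Unique-middle b₁ u))
  b₂<M = ≤∧∉⇒< b₂ (All.tail (All.++⁻ʳ b₁ b≤M)) (proj₂ (Unique-middle b₁ u))

stackGo-zero : ∀ A st → All (0 <_) st → stackGo (0 ∷ A) st ≡ 0 ∷ stackGo A st
stackGo-zero []      []           _ = refl
stackGo-zero (_ ∷ _) []           _ = refl
stackGo-zero []      (suc _ ∷ _)  _ = refl
stackGo-zero (_ ∷ _) (suc _ ∷ _)  _ = refl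
stackGo-zero _       (zero ∷ _)   (() ∷ _)

s-before-zero : ∀ L A → All (0 <_) L → s (L ++ 0 ∷ A) ≡ proj₁ (run L []) ++ 0 ∷ stackGo A (proj₂ (run L []))
s-before-zero L A L>0 = trans (stackGo-++ L (0 ∷ A) [])
  (cong (proj₁ (run L []) ++_) (stackGo-zero A _ (stack-All L [] L>0 [])))

splitOn-++ : ∀ {m} L → m ∈ L → L ≡ proj₁ (splitOn m L) ++ m ∷ proj₂ (splitOn m L)
splitOn-++ {m} (x ∷ L) m∈ with x ≟ m
... | yes refl rewrite ≡ᵇ-true (refl {x = x}) = refl
... | no x≢m rewrite ≡ᵇ-false x≢m with m∈
...   | here m≡x = contradiction (sym m≡x) x≢m
...   | there m∈L = cong (x ∷_) (splitOn-++ L m∈L)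

-- Chain L ((b₁ , c₁) ∷ (b₂ , c₂) ∷ …) cuts L = b₁ c₁ b₂ c₂ … into the blocks b_{π,i,j} and entries c_{π,i,j}
-- of a column.
data Chain : List ℕ → List (List ℕ × ℕ) → Set where
  []   : Chain [] []
  cons : ∀ {b c r bcs} → All (_< c) b → All (_< c) r → Chain r bcs → Chain (b ++ c ∷ r) ((b , c) ∷ bcs)

chainF-Chain : ∀ f L → Unique L → length L ≤ f → Chain L (chainF f L)
chainF-Chain zero    []       _ _         = []
chainF-Chain (suc f) []       _ _         = []
chainF-Chain (suc f) (x ∷ xs) u (s≤s |xs|≤f) =
  subst (λ L → Chain L (chainF (suc f) (x ∷ xs))) (sym L≡)
    (cons (≤∧∉⇒< b (All.++⁻ˡ b L≤m) m∉b) (≤∧∉⇒< r (All.tail (All.++⁻ʳ b L≤m)) m∉r)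
          (chainF-Chain f r (AllPairs-++⁻ʳ (b ++ [ m ]) (subst Unique (trans L≡ (sym (∷ʳ-++ b m r))) u)) |r|≤f))
  where
  m = maxL (x ∷ xs)
  b = proj₁ (splitOn m (x ∷ xs))
  r = proj₂ (splitOn m (x ∷ xs))
  L≡ : x ∷ xs ≡ b ++ m ∷ r
  L≡ = splitOn-++ (x ∷ xs) (maxL-∈ x xs)
  L≤m : All (_≤ m) (b ++ m ∷ r)
  L≤m = subst (All (_≤ m)) L≡ (All.tabulate (≤-maxL (x ∷ xs)))
  m∉b = proj₁ (Unique-middle b (subst Unique L≡ u))
  m∉r = proj₂ (Unique-middle b (subst Unique L≡ u))
  |r|≤f : length r ≤ f
  |r|≤f = ≤-trans (s≤s⁻¹ (≤-trans (m≤n+m (suc (length r)) (length b))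
    (≤-reflexive (sym (trans (cong length L≡) (length-++ b)))))) |xs|≤f

Chain-↭ : ∀ {L bcs} → Chain L bcs → L ↭ concatMap proj₁ bcs ++ map proj₂ bcs
Chain-↭ [] = ↭-refl
Chain-↭ (cons {b} {c} {r} {bcs} _ _ chain) = begin
  b ++ c ∷ r                                     ↭⟨ ++⁺ˡ b (↭-prep c (Chain-↭ chain)) ⟩
  b ++ c ∷ concatMap proj₁ bcs ++ map proj₂ bcs  ↭⟨ ++⁺ˡ b (shift c (concatMap proj₁ bcs) (map proj₂ bcs)) ⟨
  b ++ concatMap proj₁ bcs ++ c ∷ map proj₂ bcs  ≡⟨ ++-assoc b _ _ ⟨
  (b ++ concatMap proj₁ bcs) ++ c ∷ map proj₂ bcs ∎
  where open PermutationReasoning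

Chain-length : ∀ {L bcs} → Chain L bcs → L ≡ [] ⊎ 1 ≤ length bcs
Chain-length []           = inj₁ refl
Chain-length (cons _ _ _) = inj₂ (s≤s z≤n)

Chain-output : ∀ {L bcs} → Chain L bcs → proj₁ (run L []) ≡ concatMap (s ∘ proj₁) bcs
Chain-output [] = refl
Chain-output (cons {b} {c} {r} b<c r<c chain) =
  trans (cong proj₁ (run-split-at-max b c r b<c r<c)) (cong (s b ++_) (Chain-output chain))

BlockMaxima : List ℕ → List (List ℕ × ℕ) → Set
BlockMaxima = Sublist (λ y bc → maxᴹ (proj₁ bc) ≡ just y)

-- If L′ = s(b₁) … s(b_m) for blocks b_k with distinct entries, the leading entry c′ of a chain of L′
-- is the maximum of L′; it lies in some s(b_k), so it is max b_k, and s(b_k) ends with it.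
leading-entry-is-block-max : ∀ {b′ c′ r′} bcs₁ (b : List ℕ) (c : ℕ) bcs₂ → All (_< c′) b′ → All (_< c′) r′ →
  b′ ++ c′ ∷ r′ ≡ concatMap (s ∘ proj₁) (bcs₁ ++ (b , c) ∷ bcs₂) →
  Unique (concatMap proj₁ (bcs₁ ++ (b , c) ∷ bcs₂)) → c′ ∈ s b →
  maxᴹ b ≡ just c′ × r′ ≡ concatMap (s ∘ proj₁) bcs₂
leading-entry-is-block-max {b′} {c′} {r′} bcs₁ b c bcs₂ b′<c′ r′<c′ L′≡ u c′∈sb =
  maxᴹ-of b c′∈b b≤c′ ,
  ++-∷-cancelˡ b′ (S₁ ++ pre) L′≡′ (λ c′∈b′ → <-irrefl refl (All.lookup b′<c′ c′∈b′))
               (proj₁ (Unique-middle (S₁ ++ pre) (subst Unique L′≡′ uL′)))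
  where
  S₁ = concatMap (s ∘ proj₁) bcs₁
  S₂ = concatMap (s ∘ proj₁) bcs₂
  L′↭ : b′ ++ c′ ∷ r′ ↭ concatMap proj₁ (bcs₁ ++ (b , c) ∷ bcs₂)
  L′↭ = subst (_↭ _) (sym L′≡) (concatMap-↭ (s ∘ proj₁) proj₁ (s-↭ ∘ proj₁) (bcs₁ ++ (b , c) ∷ bcs₂))
  uL′ : Unique (b′ ++ c′ ∷ r′)
  uL′ = Unique-resp-↭ (↭-sym L′↭) u
  c′∈b : c′ ∈ b
  c′∈b = ∈-resp-↭ (s-↭ b) c′∈sb
  L′≤c′ : All (_≤ c′) (b′ ++ c′ ∷ r′)
  L′≤c′ = All.++⁺ (All.map <⇒≤ b′<c′) (≤-refl ∷ All.map <⇒≤ r′<c′)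
  b≤c′ : All (_≤ c′) b
  b≤c′ = All.tabulate λ v∈b → All.lookup L′≤c′ (∈-resp-↭ (↭-sym L′↭)
    (subst (_ ∈_) (sym (concatMap-++ proj₁ bcs₁ _)) (∈-++⁺ʳ (concatMap proj₁ bcs₁) (∈-++⁺ˡ v∈b))))
  ends = s-ends-with-max b (AllPairs-++⁻ˡ b (Unique-concatMap-suffix proj₁ bcs₁ u)) c′∈b b≤c′
  pre = proj₁ ends
  sb≡ = proj₂ ends
  open ≡-Reasoning
  L′≡′ : b′ ++ c′ ∷ r′ ≡ (S₁ ++ pre) ++ c′ ∷ S₂
  L′≡′ = begin
    b′ ++ c′ ∷ r′                                    ≡⟨ L′≡ ⟩
    concatMap (s ∘ proj₁) (bcs₁ ++ (b , c) ∷ bcs₂)   ≡⟨ concatMap-++ (s ∘ proj₁) bcs₁ _ ⟩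
    S₁ ++ s b ++ S₂                                  ≡⟨ cong (λ x → S₁ ++ x ++ S₂) sb≡ ⟩
    S₁ ++ (pre ++ [ c′ ]) ++ S₂                      ≡⟨ cong (S₁ ++_) (∷ʳ-++ pre c′ S₂) ⟩
    S₁ ++ pre ++ c′ ∷ S₂                             ≡⟨ ++-assoc S₁ pre _ ⟨
    (S₁ ++ pre) ++ c′ ∷ S₂                           ∎

Chain-of-sorted-blocks⇒BlockMaxima : ∀ {L′ bcs′} → Chain L′ bcs′ → ∀ bcs → L′ ≡ concatMap (s ∘ proj₁) bcs →
  Unique (concatMap proj₁ bcs) → BlockMaxima (map proj₂ bcs′) bcs
Chain-of-sorted-blocks⇒BlockMaxima [] bcs _ _ = minimum _
Chain-of-sorted-blocks⇒BlockMaxima (cons {b′} {c′} {r′} b′<c′ r′<c′ chain) bcs L′≡ u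
  with ∈-concatMap-split (s ∘ proj₁) bcs (subst (c′ ∈_) L′≡ (∈-++⁺ʳ b′ (here refl)))
... | bcs₁ , bcs₂ , (b , c) , refl , c′∈sb =
  ++ˡ bcs₁ (max≡ ∷ Chain-of-sorted-blocks⇒BlockMaxima chain bcs₂ r′≡
                     (AllPairs-++⁻ʳ b (Unique-concatMap-suffix proj₁ bcs₁ u)))
  where
  max≡ = proj₁ (leading-entry-is-block-max bcs₁ b c bcs₂ b′<c′ r′<c′ L′≡ u c′∈sb)
  r′≡  = proj₂ (leading-entry-is-block-max bcs₁ b c bcs₂ b′<c′ r′<c′ L′≡ u c′∈sb)

leftofIn-hit : ∀ {y} b c bcs → maxᴹ b ≡ just y → leftofIn y ((b , c) ∷ bcs) ≡ c
leftofIn-hit {y} b c bcs max≡ rewrite max≡ | ≡ᵇ-true (refl {x = y}) = refl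

leftofIn-miss : ∀ {y} b c bcs → (∀ {m} → maxᴹ b ≡ just m → m ≢ y) →
  leftofIn y ((b , c) ∷ bcs) ≡ leftofIn y bcs
leftofIn-miss b c bcs max≢y with maxᴹ b
... | just m  rewrite ≡ᵇ-false (max≢y refl) = refl
... | nothing = refl

BlockMaxima-∈ : ∀ {ys bcs} → BlockMaxima ys bcs → All (_∈ concatMap proj₁ bcs) ys
BlockMaxima-∈ []                           = []
BlockMaxima-∈ ((b , _) ∷ʳ ys⊑)             = All.map (∈-++⁺ʳ b) (BlockMaxima-∈ ys⊑)
BlockMaxima-∈ (_∷_ {y = (b , _)} max≡ ys⊑) =
  ∈-++⁺ˡ (maxᴹ-just b max≡) ∷ All.map (∈-++⁺ʳ b) (BlockMaxima-∈ ys⊑)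

leftofIn-past-block : ∀ {ys} b c bcs → Unique (b ++ concatMap proj₁ bcs) → All (_∈ concatMap proj₁ bcs) ys →
  map (λ y → leftofIn y ((b , c) ∷ bcs)) ys ≡ map (λ y → leftofIn y bcs) ys
leftofIn-past-block b c bcs u ys∈ = map-cong-local (All.map (λ y∈ → leftofIn-miss b c bcs λ max≡ m≡y →
  AllPairs-++⁻-across b u (maxᴹ-just b max≡) (subst (_∈ _) (sym m≡y) y∈) refl) ys∈)

leftofIn-⊆ : ∀ {ys bcs} → BlockMaxima ys bcs → Unique (concatMap proj₁ bcs) →
  map (λ y → leftofIn y bcs) ys ⊆ map proj₂ bcs
leftofIn-⊆ [] _ = []
leftofIn-⊆ ((b , c) ∷ʳ ys⊑) u =
  c ∷ʳ subst (_⊆ _) (sym (leftofIn-past-block b c _ u (BlockMaxima-∈ ys⊑))) (leftofIn-⊆ ys⊑ (AllPairs-++⁻ʳ b u))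
leftofIn-⊆ (_∷_ {y = (b , c)} max≡ ys⊑) u =
  leftofIn-hit b c _ max≡
  ∷ subst (_⊆ _) (sym (leftofIn-past-block b c _ u (BlockMaxima-∈ ys⊑))) (leftofIn-⊆ ys⊑ (AllPairs-++⁻ʳ b u))

findC-just : ∀ {x q} bcs → findC x bcs ≡ just q → x ∈ map proj₂ bcs
findC-just {x} ((b , c) ∷ bcs) found with c ≟ x | findC x bcs in found-bcs
... | yes refl | _       = here refl
... | no _     | just _  = there (findC-just bcs found-bcs)
... | no c≢x   | nothing = contradiction (trans (sym (if-cong (≡ᵇ-false c≢x))) found) λ ()

findC-position : ∀ {x} bcs pre {post} → map proj₂ bcs ≡ pre ++ x ∷ post → x ∉ pre →
  findC x bcs ≡ just (suc (length pre))
findC-position {x} (_ ∷ _) [] bcs≡ _ rewrite proj₁ (∷-injective bcs≡) | ≡ᵇ-true (refl {x = x}) = refl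
findC-position {x} ((_ , c) ∷ bcs) (w ∷ pre) bcs≡ x∉
  rewrite proj₁ (∷-injective bcs≡) | ≡ᵇ-false (λ w≡x → x∉ (here (sym w≡x)))
        | findC-position bcs pre (proj₂ (∷-injective bcs≡)) (x∉ ∘ there) = refl

beforeZero-++ : ∀ L A → All (0 <_) L → beforeZero (L ++ 0 ∷ A) ≡ L
beforeZero-++ []          A _          = refl
beforeZero-++ (suc x ∷ L) A (_ ∷ L>0) = cong (suc x ∷_) (beforeZero-++ L A L>0)

increasingᵇ-head : ∀ y r {z} → T (increasingᵇ (y ∷ r)) → z ∈ r → y < z
increasingᵇ-head y (w ∷ r) inc z∈ with Equivalence.to T-∧ inc | z∈
... | y<ᵇw , _   | here refl = <ᵇ⇒< y w y<ᵇw
... | y<ᵇw , inc′ | there z∈r = <-trans (<ᵇ⇒< y w y<ᵇw) (increasingᵇ-head w r inc′ z∈r)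

increasingᵇ-zero : ∀ L A → increasingᵇ (L ++ 0 ∷ A) ≡ true → L ≡ []
increasingᵇ-zero []      A _      = refl
increasingᵇ-zero (y ∷ L) A sorted =
  contradiction (increasingᵇ-head y (L ++ 0 ∷ A) (Equivalence.from T-≡ sorted) (∈-++⁺ʳ L (here refl))) λ ()

firstFrom-spec : ∀ p k f → p (firstFrom p k f) ≡ true ⊎ firstFrom p k f ≡ k + f
firstFrom-spec p k zero    = inj₂ (sym (+-identityʳ k))
firstFrom-spec p k (suc f) with p k in pk
... | true  = inj₁ pk
... | false with firstFrom-spec p (suc k) f
...   | inj₁ found     = inj₁ found
...   | inj₂ exhausted = inj₂ (trans exhausted (sym (+-suc k f)))

rowπ-col₁ : ∀ π x → colπ π x ≡ 1 → rowπ π x ≡ colposπ π x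
rowπ-col₁ π x col≡ = begin
  rowF π (colπ π x) x                                                   ≡⟨ cong (λ c → rowF π c x) col≡ ⟩
  (if colπ π x ≡ᵇ 1 then colposπ π x else rowF π 0 (leftofπ π x))      ≡⟨ if-cong (cong (_≡ᵇ 1) col≡) ⟩
  colposπ π x                                                           ∎
  where open ≡-Reasoning

rowπ-leftof : ∀ π x {c} → colπ π x ≡ suc (suc c) → colπ π (leftofπ π x) ≡ suc c →
  rowπ π x ≡ rowπ π (leftofπ π x)
rowπ-leftof π x {c} col≡ col-leftof≡ = begin
  rowF π (colπ π x) x                                                     ≡⟨ cong (λ c → rowF π c x) col≡ ⟩
  (if colπ π x ≡ᵇ 1 then colposπ π x else rowF π (suc c) (leftofπ π x))   ≡⟨ if-cong (cong (_≡ᵇ 1) col≡) ⟩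
  rowF π (suc c) (leftofπ π x)                   ≡⟨ cong (λ c → rowF π c (leftofπ π x)) col-leftof≡ ⟨
  rowF π (colπ π (leftofπ π x)) (leftofπ π x)    ∎
  where open ≡-Reasoning

module Columns (n : ℕ) (ρ : List ℕ) (ρ0↭ : ρ ++ [ 0 ] ↭ upTo (suc n)) where

  π : List ℕ
  π = ρ ++ [ 0 ]

  -- L k: the entries of s^k(π) to the left of 0 (see sIter-shape).
  L : ℕ → List ℕ
  L zero    = ρ
  L (suc k) = proj₁ (run (L k) [])

  sIter-↭ : ∀ k → sIter k π ↭ upTo (suc n)
  sIter-↭ zero    = ρ0↭
  sIter-↭ (suc k) = ↭-trans (s-↭ (sIter k π)) (sIter-↭ k)

  sIter-Unique : ∀ k → Unique (sIter k π)
  sIter-Unique k = Unique-resp-↭ (↭-sym (sIter-↭ k)) (upTo⁺ (suc n))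

  shape⇒positive : ∀ k {A} → sIter k π ≡ L k ++ 0 ∷ A → All (0 <_) (L k)
  shape⇒positive k σ≡ = All.tabulate λ x∈L → n≢0⇒n>0 λ x≡0 →
    proj₁ (Unique-middle (L k) (subst Unique σ≡ (sIter-Unique k))) (subst (_∈ L k) x≡0 x∈L)

  sIter-shape : ∀ k → ∃ λ A → sIter k π ≡ L k ++ 0 ∷ A
  sIter-shape zero    = [] , refl
  sIter-shape (suc k) with sIter-shape k
  ... | A , σ≡ = stackGo A _ , trans (cong s σ≡) (s-before-zero (L k) A (shape⇒positive k σ≡))

  L-positive : ∀ k → All (0 <_) (L k)
  L-positive k = shape⇒positive k (proj₂ (sIter-shape k))

  L-Unique : ∀ k → Unique (L k)
  L-Unique k = AllPairs-++⁻ˡ (L k) (subst Unique (proj₂ (sIter-shape k)) (sIter-Unique k))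

  L-range : ∀ {k x} → x ∈ L k → 1 ≤ x × x ≤ n
  L-range {k} {x} x∈L = All.lookup (L-positive k) x∈L ,
    s≤s⁻¹ (∈-upTo⁻ (∈-resp-↭ (sIter-↭ k) (subst (x ∈_) (sym (proj₂ (sIter-shape k))) (∈-++⁺ˡ x∈L))))

  blocks : ℕ → List (List ℕ × ℕ)
  blocks k = colData π (suc k)

  -- C k is the paper's C_{π,k+1}: column indices are shifted by one throughout.
  C : ℕ → List ℕ
  C k = map proj₂ (blocks k)

  blocks-Chain : ∀ k → Chain (L k) (blocks k)
  blocks-Chain k with sIter-shape k
  ... | A , σ≡ rewrite σ≡ | beforeZero-++ (L k) A (L-positive k) =
    chainF-Chain _ (L k) (L-Unique k) (length-++-≤ˡ (L k))

  L-suc : ∀ k → L (suc k) ≡ concatMap (s ∘ proj₁) (blocks k)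
  L-suc k = Chain-output (blocks-Chain k)

  L-↭ : ∀ k → L k ↭ concatMap proj₁ (blocks k) ++ C k
  L-↭ k = Chain-↭ (blocks-Chain k)

  L-suc-↭ : ∀ k → L (suc k) ↭ concatMap proj₁ (blocks k)
  L-suc-↭ k = subst (_↭ concatMap proj₁ (blocks k)) (sym (L-suc k))
    (concatMap-↭ (s ∘ proj₁) proj₁ (s-↭ ∘ proj₁) (blocks k))

  blocks-C-Unique : ∀ k → Unique (concatMap proj₁ (blocks k) ++ C k)
  blocks-C-Unique k = Unique-resp-↭ (L-↭ k) (L-Unique k)

  C-Unique : ∀ k → Unique (C k)
  C-Unique k = AllPairs-++⁻ʳ (concatMap proj₁ (blocks k)) (blocks-C-Unique k)

  C⊆L : ∀ {k x} → x ∈ C k → x ∈ L k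
  C⊆L {k} x∈C = ∈-resp-↭ (↭-sym (L-↭ k)) (∈-++⁺ʳ _ x∈C)

  L-suc⊆L : ∀ {k x} → x ∈ L (suc k) → x ∈ L k
  L-suc⊆L {k} x∈L = ∈-resp-↭ (↭-sym (L-↭ k)) (∈-++⁺ˡ (∈-resp-↭ (L-suc-↭ k) x∈L))

  C∉L-suc : ∀ {k x} → x ∈ C k → x ∉ L (suc k)
  C∉L-suc {k} x∈C x∈L = AllPairs-++⁻-across _ (blocks-C-Unique k) (∈-resp-↭ (L-suc-↭ k) x∈L) x∈C refl

  L-split : ∀ {k x} → x ∈ L k → x ∈ C k ⊎ x ∈ L (suc k)
  L-split {k} x∈L with ∈-++⁻ (concatMap proj₁ (blocks k)) (∈-resp-↭ (L-↭ k) x∈L)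
  ... | inj₁ x∈blocks = inj₂ (∈-resp-↭ (↭-sym (L-suc-↭ k)) x∈blocks)
  ... | inj₂ x∈C      = inj₁ x∈C

  L-antitone : ∀ {j k x} → j ≤ k → x ∈ L k → x ∈ L j
  L-antitone {k = zero}  z≤n x∈L = x∈L
  L-antitone {k = suc k} j≤k x∈L with m≤n⇒m<n∨m≡n j≤k
  ... | inj₂ refl = x∈L
  ... | inj₁ j<k  = L-antitone (s≤s⁻¹ j<k) (L-suc⊆L {k} x∈L)

  C-disjoint : ∀ {j k x} → x ∈ C j → x ∈ C k → j ≡ k
  C-disjoint {j} {k} x∈Cj x∈Ck with <-cmp j k
  ... | tri< j<k _ _ = contradiction (L-antitone j<k (C⊆L {k} x∈Ck)) (C∉L-suc {j} x∈Cj)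
  ... | tri≈ _ j≡k _ = j≡k
  ... | tri> _ _ k<j = contradiction (L-antitone k<j (C⊆L {j} x∈Cj)) (C∉L-suc {k} x∈Ck)

  length-L : ∀ k → length (L k) ≡ length (L (suc k)) + length (blocks k)
  length-L k = begin
    length (L k)
      ≡⟨ ↭-length (L-↭ k) ⟩
    length (concatMap proj₁ (blocks k) ++ C k)
      ≡⟨ length-++ (concatMap proj₁ (blocks k)) ⟩
    length (concatMap proj₁ (blocks k)) + length (C k)
      ≡⟨ cong₂ _+_ (↭-length (L-suc-↭ k)) (sym (length-map proj₂ (blocks k))) ⟨
    length (L (suc k)) + length (blocks k)
      ∎
    where open ≡-Reasoning

  L-shrinks : ∀ k → L k ≡ [] ⊎ length (L (suc k)) < length (L k)
  L-shrinks k with Chain-length (blocks-Chain k)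
  ... | inj₁ Lk≡[]      = inj₁ Lk≡[]
  ... | inj₂ 1≤|blocks| = inj₂ (subst (length (L (suc k)) <_) (sym (length-L k)) (m<m+n _ 1≤|blocks|))

  length-π : length π ≡ suc n
  length-π = trans (↭-length ρ0↭) (length-upTo (suc n))

  length-ρ : length ρ ≡ n
  length-ρ = suc-injective (trans (sym (trans (length-++ ρ) (+-comm (length ρ) 1))) length-π)

  length-L-≤ : ∀ k → length (L k) ≤ n ∸ k
  length-L-≤ zero    = ≤-reflexive length-ρ
  length-L-≤ (suc k) with L-shrinks k
  ... | inj₁ Lk≡[]  rewrite Lk≡[] = z≤n
  ... | inj₂ shrinks =
    subst (length (L (suc k)) ≤_) (pred[m∸n]≡m∸[1+n] n k) (pred-mono-≤ (≤-trans shrinks (length-L-≤ k)))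

  L-n-empty : L n ≡ []
  L-n-empty with L n | length-L-≤ n
  ... | []     | _     = refl
  ... | _ ∷ xs | bound = contradiction (subst (suc (length xs) ≤_) (n∸n≡0 n) bound) λ ()

  -- Either s^{sc π}(π) is increasing, so nothing precedes its 0, or the search in sc ran out of fuel at
  -- length π = n + 1, and L n is already empty because L shrinks at every step.
  L-sc-empty : L (sc π) ≡ []
  L-sc-empty with firstFrom-spec (λ k → increasingᵇ (sIter k π)) 0 (length π)
  ... | inj₁ sorted with sIter-shape (sc π)
  ...   | A , σ≡ = increasingᵇ-zero (L (sc π)) A (subst (λ σ → increasingᵇ σ ≡ true) σ≡ sorted)
  L-sc-empty | inj₂ sc≡ = subst (λ k → L k ≡ []) (sym (trans sc≡ length-π))
    (cong (λ l → proj₁ (run l [])) L-n-empty)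

  C-below-sc : ∀ {j x} → x ∈ C j → j < sc π
  C-below-sc {j} x∈C with sc π ≤? j
  ... | no  sc≰j = ≰⇒> sc≰j
  ... | yes sc≤j = contradiction (subst (_ ∈_) L-sc-empty (L-antitone sc≤j (C⊆L {j} x∈C))) λ ()

  ∈-C-before : ∀ {x} k m → x ∈ L k → x ∉ L (k + m) → ∃ λ j → x ∈ C j
  ∈-C-before {x} k zero    x∈L x∉L = contradiction (subst (λ i → x ∈ L i) (sym (+-identityʳ k)) x∈L) x∉L
  ∈-C-before {x} k (suc m) x∈L x∉L with L-split {k} x∈L
  ... | inj₁ x∈C     = k , x∈C
  ... | inj₂ x∈L-suc = ∈-C-before (suc k) m x∈L-suc (subst (λ i → x ∉ L i) (+-suc k m) x∉L)

  ∈-C : ∀ {x} → 1 ≤ x → x ≤ n → ∃ λ j → x ∈ C j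
  ∈-C {x} 1≤x x≤n = ∈-C-before 0 (sc π) x∈ρ (subst (x ∉_) (sym L-sc-empty) λ ())
    where
    x∈ρ : x ∈ ρ
    x∈ρ with ∈-++⁻ ρ (∈-resp-↭ (↭-sym ρ0↭) (∈-upTo⁺ (s≤s x≤n)))
    ... | inj₁ x∈ρ         = x∈ρ
    ... | inj₂ (here refl) = contradiction 1≤x λ ()

  searchCol-C : ∀ f a {x j p} → x ∈ C j → a ≤ j → j < a + f → findC x (blocks j) ≡ just p →
    searchCol π x (suc a) f ≡ (suc j , p)
  searchCol-C zero    a {j = j} _ a≤j j<a+0 _ = contradiction (subst (j <_) (+-identityʳ a) j<a+0) (≤⇒≯ a≤j)
  searchCol-C (suc f) a {x} {j} x∈C a≤j j<a+f found with findC x (colData π (suc a)) in found-a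
  ... | just q with C-disjoint {a} {j} (findC-just (blocks a) found-a) x∈C
  ...   | refl = cong (suc a ,_) (just-injective (trans (sym found-a) found))
  searchCol-C (suc f) a {x} {j} x∈C a≤j j<a+f found | nothing with a ≟ j
  ... | yes refl = contradiction (trans (sym found-a) found) λ ()
  ... | no  a≢j  = searchCol-C f (suc a) x∈C (≤∧≢⇒< a≤j a≢j) (subst (j <_) (+-suc a f) j<a+f) found

  colColpos-C : ∀ {j x} pre {post} → C j ≡ pre ++ x ∷ post → colColpos π x ≡ (suc j , suc (length pre))
  colColpos-C {j} pre C≡ = searchCol-C (sc π) 0 x∈C z≤n (C-below-sc x∈C)
    (findC-position (blocks j) pre C≡ (proj₁ (Unique-middle pre (subst Unique C≡ (C-Unique j)))))
    where x∈C = subst (_ ∈_) (sym C≡) (∈-++⁺ʳ pre (here refl))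

  col-C : ∀ {j x} → x ∈ C j → colπ π x ≡ suc j
  col-C x∈C with ∈-∃++ x∈C
  ... | pre , _ , C≡ = cong proj₁ (colColpos-C pre C≡)

  row : ℕ → ℕ
  row = rowπ π

  leftof-C : ∀ {j y} → y ∈ C (suc j) → leftofπ π y ≡ leftofIn y (blocks j)
  leftof-C {j} {y} y∈C = cong (λ c → leftofIn y (colData π (c ∸ 1))) (col-C {suc j} y∈C)

  leftofIn-C-⊆ : ∀ j → map (λ y → leftofIn y (blocks j)) (C (suc j)) ⊆ C j
  leftofIn-C-⊆ j = leftofIn-⊆
    (Chain-of-sorted-blocks⇒BlockMaxima (blocks-Chain (suc j)) (blocks j) (L-suc j) blocks-Unique) blocks-Unique
    where blocks-Unique = AllPairs-++⁻ˡ (concatMap proj₁ (blocks j)) (blocks-C-Unique j)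

  leftof-∈-C : ∀ {j y} → y ∈ C (suc j) → leftofπ π y ∈ C j
  leftof-∈-C {j} y∈C = subst (_∈ C j) (sym (leftof-C {j} y∈C)) (⊆-lookup (leftofIn-C-⊆ j) (∈-map⁺ _ y∈C))

  row-C-zero : ∀ {x} → x ∈ C 0 → row x ≡ colposπ π x
  row-C-zero {x} x∈C = rowπ-col₁ π x (col-C {0} x∈C)

  row-leftof : ∀ {j y} → y ∈ C (suc j) → row y ≡ row (leftofπ π y)
  row-leftof {j} {y} y∈C = rowπ-leftof π y (col-C {suc j} y∈C) (col-C {j} (leftof-∈-C {j} y∈C))

  rows : ℕ → List ℕ
  rows j = map row (C j)

  rows-zero : rows 0 ≡ oneTo (length (C 0))
  rows-zero = map≡applyUpTo row suc (C 0) λ pre C≡ →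
    trans (row-C-zero (subst (_ ∈_) (sym C≡) (∈-++⁺ʳ pre (here refl)))) (cong proj₂ (colColpos-C {0} pre C≡))

  rows-suc-⊆ : ∀ j → rows (suc j) ⊆ rows j
  rows-suc-⊆ j = subst (_⊆ rows j) (sym rows≡) (⊆-map⁺ row (leftofIn-C-⊆ j))
    where
    rows≡ : rows (suc j) ≡ map row (map (λ y → leftofIn y (blocks j)) (C (suc j)))
    rows≡ = trans (map-cong-local (All.tabulate λ y∈C →
                      trans (row-leftof {j} y∈C) (cong row (leftof-C {j} y∈C))))
                  (map-∘ (C (suc j)))

  rows-⊆-oneTo : ∀ j → rows j ⊆ oneTo (length (C 0))
  rows-⊆-oneTo zero    = ⊆-reflexive rows-zero
  rows-⊆-oneTo (suc j) = ⊆-trans (rows-suc-⊆ j) (rows-⊆-oneTo j)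

  rows-increasing : ∀ j → AllPairs _<_ (rows j)
  rows-increasing j = AllPairs-resp-⊆ (rows-⊆-oneTo j) (oneTo-increasing _)

  rows-antitone : ∀ {j k r} → j ≤ k → r ∈ rows k → r ∈ rows j
  rows-antitone {k = zero}  z≤n r∈ = r∈
  rows-antitone {k = suc k} j≤k r∈ with m≤n⇒m<n∨m≡n j≤k
  ... | inj₂ refl = r∈
  ... | inj₁ j<k  = rows-antitone (s≤s⁻¹ j<k) (⊆-lookup (rows-suc-⊆ k) r∈)

  rowClass : ℕ → List ℕ
  rowClass r = filterᵇ (λ x → row x ≡ᵇ r) (oneTo n)

  count : ℕ → ℕ
  count r = length (rowClass r)

  rowClass-Unique : ∀ r → Unique (rowClass r)
  rowClass-Unique r = Unique.filter⁺ (T? ∘ λ x → row x ≡ᵇ r) (increasing⇒Unique (oneTo-increasing n))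

  ∈-rowClass⁺ : ∀ {j y} → y ∈ C j → y ∈ rowClass (row y)
  ∈-rowClass⁺ {j} {y} y∈C = ∈-filter⁺ (T? ∘ λ x → row x ≡ᵇ row y)
    (∈-oneTo⁺ (proj₁ y-range) (proj₂ y-range)) (≡⇒≡ᵇ (row y) (row y) refl)
    where y-range = L-range {j} (C⊆L {j} y∈C)

  ∈-rowClass⁻ : ∀ {x r} → x ∈ rowClass r → ∃ λ j → x ∈ C j × row x ≡ r
  ∈-rowClass⁻ {x} {r} x∈ with ∈-filter⁻ (T? ∘ λ x → row x ≡ᵇ r) {xs = oneTo n} x∈
  ... | x∈oneTo , row≡ with ∈-C (proj₁ (∈-oneTo⁻ x∈oneTo)) (proj₂ (∈-oneTo⁻ x∈oneTo))
  ...   | j , x∈C = j , x∈C , ≡ᵇ⇒≡ (row x) r row≡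

  -- Row r meets the columns 1, …, j + 1 when it meets column j + 1, and distinct entries of row r lie in
  -- distinct columns; so α_r, the number of entries of row r, is the number of columns meeting row r.
  count-≥ : ∀ {j r} → r ∈ rows j → suc j ≤ count r
  count-≥ {j} {r} r∈rows = begin
    suc j                              ≡⟨ length-applyUpTo suc (suc j) ⟨
    length (oneTo (suc j))
      ≤⟨ Unique⇒length-≤ (increasing⇒Unique (oneTo-increasing (suc j))) cols⊆ ⟩
    length (map (colπ π) (rowClass r)) ≡⟨ length-map (colπ π) (rowClass r) ⟩
    count r                            ∎
    where
    open ≤-Reasoning
    cols⊆ : ∀ {i} → i ∈ oneTo (suc j) → i ∈ map (colπ π) (rowClass r)
    cols⊆ i∈ with ∈-applyUpTo⁻ suc i∈
    ... | k , k<1+j , refl with ∈-map⁻ row (rows-antitone {k} {j} (s≤s⁻¹ k<1+j) r∈rows)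
    ...   | y , y∈C , r≡ = subst (_∈ map (colπ π) (rowClass r)) (col-C {k} y∈C)
                             (∈-map⁺ (colπ π) (subst (λ r → y ∈ rowClass r) (sym r≡) (∈-rowClass⁺ {k} y∈C)))

  count-≤ : ∀ {j r} → r ∉ rows j → count r ≤ j
  count-≤ {j} {r} r∉rows = begin
    count r                            ≡⟨ length-map (colπ π) (rowClass r) ⟨
    length (map (colπ π) (rowClass r))
      ≤⟨ Unique⇒length-≤ (map-Unique (colπ π) (rowClass-Unique r) col-injective) cols⊆ ⟩
    length (oneTo j)                   ≡⟨ length-applyUpTo suc j ⟩
    j                                  ∎
    where
    open ≤-Reasoning
    cols⊆ : ∀ {i} → i ∈ map (colπ π) (rowClass r) → i ∈ oneTo j
    cols⊆ i∈ with ∈-map⁻ (colπ π) i∈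
    ... | x , x∈ , refl with ∈-rowClass⁻ x∈
    ...   | k , x∈C , row≡ with j ≤? k
    ...     | yes j≤k = contradiction (rows-antitone j≤k (subst (_∈ rows k) row≡ (∈-map⁺ row x∈C))) r∉rows
    ...     | no  j≰k = subst (_∈ oneTo j) (sym (col-C {k} x∈C)) (∈-oneTo⁺ (s≤s z≤n) (≰⇒> j≰k))
    col-injective : ∀ {x y} → x ∈ rowClass r → y ∈ rowClass r → colπ π x ≡ colπ π y → x ≡ y
    col-injective x∈ y∈ col≡ with ∈-rowClass⁻ x∈ | ∈-rowClass⁻ y∈
    ... | k , x∈C , row-x | k′ , y∈C , row-y
      with suc-injective (trans (sym (col-C {k} x∈C)) (trans col≡ (col-C {k′} y∈C)))
    ...   | refl =
      Unique-map⇒injective row (increasing⇒Unique (rows-increasing k)) x∈C y∈C (trans row-x (sym row-y))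

  ∈-rows : ∀ {j r} → suc j ≤ count r → r ∈ rows j
  ∈-rows {j} {r} 1+j≤count with r ∈? rows j
  ... | yes r∈ = r∈
  ... | no  r∉ = contradiction (≤-trans 1+j≤count (count-≤ r∉)) (<-irrefl refl)

  α : List ℕ
  α = alphaπ n π

  length-α : length α ≡ length (C 0)
  length-α = trans (length-map _ (oneTo (length (blocks 0))))
                   (trans (length-applyUpTo suc (length (blocks 0))) (sym (length-map proj₂ (blocks 0))))

  α-entry : ∀ {r} → 1 ≤ r → r ≤ length (C 0) → nthD 0 α r ≡ count r
  α-entry {suc t} _ r≤ = nthD-map-applyUpTo 0 (λ j → length (filterᵇ (λ x → row x ≡ᵇ j) (oneTo n))) suc
    (subst (suc t ≤_) (length-map proj₂ (blocks 0)) r≤)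

  inD-α : ∀ {j r} → r ∈ oneTo (length (C 0)) → inDᵇ α (suc j , r) ≡ (suc j ≤ᵇ count r)
  inD-α {j} {r} r∈ rewrite ≤ᵇ-true (proj₁ (∈-oneTo⁻ r∈))
                         | ≤ᵇ-true (subst (r ≤_) (sym length-α) (proj₂ (∈-oneTo⁻ r∈)))
                         | α-entry (proj₁ (∈-oneTo⁻ r∈)) (proj₂ (∈-oneTo⁻ r∈)) = refl

  inD-α⁺ : ∀ {j v} → v ∈ rows j → T (inDᵇ α (suc j , v))
  inD-α⁺ {j} v∈rows = subst T (sym (inD-α (⊆-lookup (rows-⊆-oneTo j) v∈rows))) (≤⇒≤ᵇ (count-≥ v∈rows))

  inD-α⁻ : ∀ {j v} → v ∈ oneTo (length (C 0)) → T (inDᵇ α (suc j , v)) → v ∈ rows j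
  inD-α⁻ {j} v∈ inD = ∈-rows {j} (≤ᵇ⇒≤ _ _ (subst T (inD-α v∈) inD))

  rows-split : ∀ {j x} pre {post} → C j ≡ pre ++ x ∷ post → rows j ≡ map row pre ++ row x ∷ map row post
  rows-split {x = x} pre {post} C≡ = trans (cong (map row) C≡) (map-++ row pre (x ∷ post))

  rows-split-increasing : ∀ {j x} pre {post} → C j ≡ pre ++ x ∷ post →
    AllPairs _<_ (map row pre ++ row x ∷ map row post)
  rows-split-increasing {j} pre C≡ = subst (AllPairs _<_) (rows-split {j} pre C≡) (rows-increasing j)

  Uset-C : ∀ {j x} pre {post} → C j ≡ pre ++ x ∷ post → Uset α (suc j , row x) ≡ map row pre
  Uset-C {j} {x} pre C≡ = increasing-≡
    (AllPairs.filter⁺ (T? ∘ inD) (oneTo-increasing (row x ∸ 1))) (AllPairs-++⁻ˡ (map row pre) increasing)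
    ⊆pre pre⊆
    where
    inD = λ v → inDᵇ α (suc j , v)
    increasing = rows-split-increasing {j} pre C≡
    x-range = ∈-oneTo⁻ (⊆-lookup (rows-⊆-oneTo j) (subst (row x ∈_) (sym (rows-split {j} pre C≡))
                                                          (∈-++⁺ʳ (map row pre) (here refl))))
    ⊆pre : ∀ {v} → v ∈ filterᵇ inD (oneTo (row x ∸ 1)) → v ∈ map row pre
    ⊆pre {v} v∈ with ∈-filter⁻ (T? ∘ inD) {xs = oneTo (row x ∸ 1)} v∈
    ... | v∈oneTo , inD-v = ∈-increasing-prefix (map row pre) increasing
      (subst (v ∈_) (rows-split {j} pre C≡) (inD-α⁻ {j} v∈C₀ inD-v)) v<r
      where
      v<r = ≤∸1⇒< (proj₁ x-range) (proj₂ (∈-oneTo⁻ v∈oneTo))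
      v∈C₀ = ∈-oneTo⁺ (proj₁ (∈-oneTo⁻ v∈oneTo)) (≤-trans (<⇒≤ v<r) (proj₂ x-range))
    pre⊆ : ∀ {v} → v ∈ map row pre → v ∈ filterᵇ inD (oneTo (row x ∸ 1))
    pre⊆ {v} v∈ = ∈-filter⁺ (T? ∘ inD)
      (∈-oneTo⁺ (proj₁ (∈-oneTo⁻ (⊆-lookup (rows-⊆-oneTo j) v∈rows)))
                (<⇒≤∸1 (AllPairs-++⁻-across (map row pre) increasing v∈ (here refl))))
      (inD-α⁺ v∈rows)
      where v∈rows = subst (v ∈_) (sym (rows-split {j} pre C≡)) (∈-++⁺ˡ v∈)

  colpos-T : ∀ {j x} → x ∈ C j → colposπ π x ≡ colposα α (Tπ π x)
  colpos-T {j} {x} x∈C with ∈-∃++ x∈C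
  ... | pre , _ , C≡ = begin
    colposπ π x                               ≡⟨ cong proj₂ (colColpos-C {j} pre C≡) ⟩
    suc (length pre)                          ≡⟨ cong suc (length-map row pre) ⟨
    suc (length (map row pre))                ≡⟨ cong (suc ∘ length) (Uset-C {j} pre C≡) ⟨
    suc (length (Uset α (suc j , row x)))     ≡⟨ cong (λ c → suc (length (Uset α (c , row x)))) col≡ ⟨
    suc (length (Uset α (colπ π x , row x)))  ∎
    where
    open ≡-Reasoning
    col≡ = col-C {j} x∈C

  leftof-T : ∀ {j x} → x ∈ C j → 1 < colπ π x → Tπ π (leftofπ π x) ≡ leftofα α (Tπ π x)
  leftof-T {zero}  x∈C 1<col = contradiction (subst (1 <_) (col-C {0} x∈C) 1<col) (<-irrefl refl)
  leftof-T {suc j} x∈C _     = cong₂ _,_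
    (trans (col-C {j} (leftof-∈-C {j} x∈C)) (cong (_∸ 1) (sym (col-C {suc j} x∈C))))
    (sym (row-leftof {j} x∈C))

  upof-C : ∀ {j x y} pre {post} → C j ≡ pre ++ y ∷ x ∷ post → upofπ π x ≡ y
  upof-C {j} {x} {y} pre {post} C≡ = begin
    upofπ π x
      ≡⟨ cong₂ (λ c p → proj₂ (nthD ([] , 0) (colData π c) (p ∸ 1)))
               (col-C {j} x∈C) (cong proj₂ (colColpos-C {j} (pre ++ [ y ]) C≡′)) ⟩
    proj₂ (nthD ([] , 0) (blocks j) (length (pre ++ [ y ])))
      ≡⟨ cong (proj₂ ∘ nthD ([] , 0) (blocks j)) (trans (length-++ pre) (+-comm (length pre) 1)) ⟩
    proj₂ (nthD ([] , 0) (blocks j) (suc (length pre)))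
      ≡⟨ nthD-position ([] , 0) (blocks j) pre C≡ ⟩
    y ∎
    where
    open ≡-Reasoning
    C≡′ : C j ≡ (pre ++ [ y ]) ++ x ∷ post
    C≡′ = trans C≡ (sym (∷ʳ-++ pre y (x ∷ post)))
    x∈C = subst (x ∈_) (sym C≡′) (∈-++⁺ʳ (pre ++ [ y ]) (here refl))

  upof-T : ∀ {j x} → x ∈ C j → 1 < colposπ π x → Tπ π (upofπ π x) ≡ upofα α (Tπ π x)
  upof-T {j} {x} x∈C 1<colpos with ∈-∃++ x∈C
  ... | pre , post , C≡ with initLast pre
  ...   | [] = contradiction (subst (1 <_) (cong proj₂ (colColpos-C {j} [] C≡)) 1<colpos) (<-irrefl refl)
  ...   | pre′ ∷ʳ′ y = cong₂ _,_ col≡ row≡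
    where
    open ≡-Reasoning
    C≡′ : C j ≡ pre′ ++ y ∷ x ∷ post
    C≡′ = trans C≡ (∷ʳ-++ pre′ y (x ∷ post))
    upof≡ = upof-C {j} pre′ C≡′
    col≡ : colπ π (upofπ π x) ≡ colπ π x
    col≡ = trans (cong (colπ π) upof≡)
                 (trans (col-C {j} (subst (y ∈_) (sym C≡′) (∈-++⁺ʳ pre′ (here refl)))) (sym (col-C {j} x∈C)))
    increasing : AllPairs _<_ (map row pre′ ++ [ row y ])
    increasing = subst (AllPairs _<_) (map-++ row pre′ [ y ])
      (AllPairs-++⁻ˡ (map row (pre′ ++ [ y ])) (rows-split-increasing {j} (pre′ ++ [ y ]) C≡))
    row≡ : row (upofπ π x) ≡ maxL (Uset α (colπ π x , row x))
    row≡ = begin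
      row (upofπ π x)                   ≡⟨ cong row upof≡ ⟩
      row y                             ≡⟨ maxL-increasing (map row pre′) increasing ⟨
      maxL (map row pre′ ++ [ row y ])  ≡⟨ cong maxL (map-++ row pre′ [ y ]) ⟨
      maxL (map row (pre′ ++ [ y ]))        ≡⟨ cong maxL (Uset-C {j} (pre′ ++ [ y ]) C≡) ⟨
      maxL (Uset α (suc j , row x))     ≡⟨ cong (λ c → maxL (Uset α (c , row x))) (col-C {j} x∈C) ⟨
      maxL (Uset α (colπ π x , row x))  ∎

lemma4p2 : (n : ℕ) (π : List ℕ) → S′ n π → (x : ℕ) → 1 ≤ x → x ≤ n →
    (colπ π x ≡ colα (alphaπ n π) (Tπ π x))
    × (rowπ π x ≡ rowα (alphaπ n π) (Tπ π x))
    × (colposπ π x ≡ colposα (alphaπ n π) (Tπ π x))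
    × (1 < colπ π x → Tπ π (leftofπ π x) ≡ leftofα (alphaπ n π) (Tπ π x))
    × (1 < colposπ π x → Tπ π (upofπ π x) ≡ upofα (alphaπ n π) (Tπ π x))
lemma4p2 n .(ρ ++ [ 0 ]) (ρ0↭ , ρ , refl) x 1≤x x≤n with Columns.∈-C n ρ ρ0↭ 1≤x x≤n
... | j , x∈C = refl , refl , colpos-T {j} x∈C , leftof-T {j} x∈C , upof-T {j} x∈C
  where open Columns n ρ ρ0↭
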